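{- Let $G$ be a König–Egerváry graph such that for some maximum stable set $S$ of $G$, the edge set $(S,V(G)-S)$ (all edges with one endpoint in $S$ and the other in $V(G)-S$) forms a forest (contains no cycle). Then $\xi(G)+\eta(G)=\alpha(G)$, $\sigma(G)+\eta(G)=\mu(G)$, and $\xi(G)+2\eta(G)+\sigma(G)=n(G)$.
   Context: All graphs are finite and simple; "graph" means a connected graph with at least one edge. $\alpha(G)$ is the stability number, $\mu(G)$ the maximum matching size, $n(G)=|V(G)|$; $G$ is König–Egerváry if $\alpha(G)+\mu(G)=n(G)$. $\Omega(G)$ is the set of maximum stable sets, $\mathrm{core}(G)=\bigcap\{S:S\in\Omega(G)\}$, $\xi(G)=|\mathrm{core}(G)|$, $\sigma(G)=\left|\bigcap\{V(G)-S:S\in\Omega(G)\}\right|$. An edge $e$ is $\alpha$-critical if $\alpha(G-e)>\alpha(G)$ ($G-e$ being $G$ with $e$ deleted); $\eta(G)$ is the number of $\alpha$-critical edges of $G$. -}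

module Defs where

open import Data.Bool using (Bool; true; false; _∧_; _∨_; not; _xor_; if_then_else_)
open import Data.Nat using (ℕ; zero; suc; _+_; _⊔_; _<_)
open import Data.Fin using (Fin; zero; suc; inject₁; fromℕ; _≟_)
open import Data.Fin.Subset using (Subset; ∣_∣)
open import Data.Vec using (Vec; []; _∷_; lookup)
open import Data.List using (List; []; _∷_; map; filter; length; _++_; foldr; allFin; concatMap)
open import Data.List.Relation.Unary.All using (All)
open import Data.Product using (Σ; ∃; _×_; _,_)
open import Relation.Binary.PropositionalEquality using (_≡_)
open import Relation.Nullary.Decidable using (does)
open import Function.Definitions using (Injective)

Adj : ℕ → Set
Adj n = Fin n → Fin n → Bool

record Graph (n : ℕ) : Set where
  field
    adj    : Adj n
    sym    : ∀ x y → adj x y ≡ adj y x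
    irrefl : ∀ x → adj x x ≡ false
open Graph public

data Reach {n : ℕ} (a : Adj n) : Fin n → Fin n → Set where
  here : ∀ {x} → Reach a x x
  step : ∀ {x y z} → a x y ≡ true → Reach a y z → Reach a x z

Connected : ∀ {n} → Graph n → Set
Connected G = ∀ u v → Reach (adj G) u v

HasEdge : ∀ {n} → Graph n → Set
HasEdge G = ∃ λ u → ∃ λ v → adj G u v ≡ true

allSubsets : (n : ℕ) → List (Subset n)
allSubsets zero    = [] ∷ []
allSubsets (suc n) = map (true ∷_) (allSubsets n) ++ map (false ∷_) (allSubsets n)

maxList : List ℕ → ℕ
maxList = foldr _⊔_ 0

countB : ∀ {A : Set} → (A → Bool) → List A → ℕ
countB p xs = length (filter (λ x → Data.Bool._≟_ (p x) true) xs)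
  where import Data.Bool

allB : ∀ {A : Set} → (A → Bool) → List A → Bool
allB p = foldr (λ x b → p x ∧ b) true

anyB : ∀ {A : Set} → (A → Bool) → List A → Bool
anyB p = foldr (λ x b → p x ∨ b) false

isStable : ∀ {n} → Adj n → Subset n → Bool
isStable {n} a S =
  allB (λ x → allB (λ y → not (lookup S x ∧ lookup S y ∧ a x y)) (allFin n)) (allFin n)

stableSets : ∀ {n} → Adj n → List (Subset n)
stableSets {n} a = filter (λ S → Data.Bool._≟_ (isStable a S) true) (allSubsets n)
  where import Data.Bool

α : ∀ {n} → Adj n → ℕ
α a = maxList (map ∣_∣ (stableSets a))

Ω : ∀ {n} → Adj n → List (Subset n)
Ω a = filter (λ S → ∣ S ∣ Data.Nat.≟ α a) (stableSets a)
  where import Data.Nat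

IsMaxStable : ∀ {n} → Adj n → Subset n → Set
IsMaxStable a S = isStable a S ≡ true × ∣ S ∣ ≡ α a

ξ : ∀ {n} → Adj n → ℕ
ξ {n} a = countB (λ v → allB (λ S → lookup S v) (Ω a)) (allFin n)

σ : ∀ {n} → Adj n → ℕ
σ {n} a = countB (λ v → allB (λ S → not (lookup S v)) (Ω a)) (allFin n)

edges : ∀ {n} → Adj n → List (Fin n × Fin n)
edges {n} a = concatMap (λ x → filter (λ e → Data.Bool._≟_ (ok e) true)
                                  (map (λ y → (x , y)) (allFin n))) (allFin n)
  where
  import Data.Bool
  import Data.Fin
  ok : Fin n × Fin n → Bool
  ok (x , y) = does (x Data.Fin.<? y) ∧ a x y

sublists : ∀ {A : Set} → List A → List (List A)
sublists []       = [] ∷ []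
sublists (x ∷ xs) = map (x ∷_) (sublists xs) ++ sublists xs

eqF : ∀ {n} → Fin n → Fin n → Bool
eqF x y = does (x ≟ y)

disjointE : ∀ {n} → Fin n × Fin n → Fin n × Fin n → Bool
disjointE (x , y) (u , v) = not (eqF x u ∨ eqF x v ∨ eqF y u ∨ eqF y v)

isMatching : ∀ {n} → List (Fin n × Fin n) → Bool
isMatching []       = true
isMatching (e ∷ es) = allB (disjointE e) es ∧ isMatching es

μ : ∀ {n} → Adj n → ℕ
μ a = maxList (map length (filter (λ M → Data.Bool._≟_ (isMatching M) true)
                                  (sublists (edges a))))
  where import Data.Bool

IsKE : ∀ {n} → Graph n → Set
IsKE {n} G = α (adj G) + μ (adj G) ≡ n

deleteEdge : ∀ {n} → Adj n → Fin n × Fin n → Adj n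
deleteEdge a (u , v) x y = a x y ∧ not ((eqF x u ∧ eqF y v) ∨ (eqF x v ∧ eqF y u))

isαCritical : ∀ {n} → Adj n → Fin n × Fin n → Bool
isαCritical a e = does (α a Data.Nat.<? α (deleteEdge a e))
  where import Data.Nat

η : ∀ {n} → Adj n → ℕ
η a = countB (isαCritical a) (edges a)

cutAdj : ∀ {n} → Adj n → Subset n → Adj n
cutAdj a S x y = a x y ∧ (lookup S x xor lookup S y)

-- a cycle: k = m + 3 pairwise distinct vertices f 0, …, f (k-1) with
-- f i ~ f (i+1) and f (k-1) ~ f 0
HasCycle : ∀ {n} → Adj n → Set
HasCycle {n} a =
  Σ ℕ λ m → Σ (Fin (suc (suc (suc m))) → Fin n) λ f →
    Injective _≡_ _≡_ f
    × (∀ (i : Fin (suc (suc m))) → a (f (inject₁ i)) (f (suc i)) ≡ true)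
    × a (f (fromℕ (suc (suc m)))) (f zero) ≡ true

IsForest : ∀ {n} → Adj n → Set
IsForest a = HasCycle a → Data.Empty.⊥
  where import Data.Empty

{-# OPTIONS --safe #-}
module Submission where

-- Fix a maximum matching M, and let c be the number of vertices it leaves uncovered, so that
-- n = c + 2μ and, G being König–Egerváry, α = c + μ. Counting a stable set along M shows
-- that every maximum stable set contains all uncovered vertices and exactly one end of each
-- edge of M; in particular every α-critical edge lies in M, since M is still a matching of
-- G − e for e ∉ M. If xy is α-critical, a maximum stable set of G − xy has α + 1 vertices
-- and contains x and y; removing either end leaves a maximum stable set of G, so x and y lie
-- neither in the core nor outside the corona ⋃ Ω. If st ∈ M is not α-critical and s ∈ S,
-- then s lies in every maximum stable set T: otherwise t ∈ T, and taking T on the vertices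
-- reachable from t in the forest (S, V − S) − st and S elsewhere gives a stable set of
-- G − st with α + 1 vertices. Hence ξ = c + (number of non-critical edges of M),
-- σ = (number of non-critical edges of M), η = (number of critical edges of M), which gives
-- the three identities.

open import Defs hiding (sym)
open import Algebra.Properties.CommutativeSemigroup using (interchange)
open import Data.Bool as Bool using (Bool; true; false; _∧_; _∨_; _xor_; not; if_then_else_)
import Data.Bool.Properties as Boolₚ
open import Data.Empty using (⊥; ⊥-elim)
open import Data.Fin as Fin using (Fin; zero; suc; inject₁; fromℕ)
open import Data.Fin.Subset using (Subset; ∣_∣)
open import Data.List as List using (List; []; _∷_; length; filter; map; allFin)
open import Data.List.Membership.Propositional using (_∈_)
open import Data.List.Membership.Propositional.Properties
open import Data.List.Relation.Binary.Disjoint.Propositional using (Disjoint)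
open import Data.List.Relation.Unary.All as All using (All; []; _∷_)
import Data.List.Relation.Unary.All.Properties as Allₚ
open import Data.List.Relation.Unary.AllPairs as AllPairs using (AllPairs; _∷_)
import Data.List.Relation.Unary.AllPairs.Properties as AllPairsₚ
open import Data.List.Relation.Unary.Any as Any using (here; there)
open import Data.List.Relation.Unary.Unique.Propositional using (Unique)
import Data.List.Relation.Unary.Unique.Propositional.Properties as Uniqueₚ
open import Data.Nat as ℕ using (ℕ; _+_; _*_; _≤_; _<_; z≤n; s≤s)
open import Data.Nat.Properties
open import Data.Nat.Solver using (module +-*-Solver)
open +-*-Solver using (solve; _:=_; _:+_; _:*_; con)
open import Data.Product using (∃; _×_; _,_; proj₁; proj₂)
open import Data.Product.Properties using (≡-dec)
open import Data.Sum using (_⊎_; inj₁; inj₂; [_,_]′; swap)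
open import Data.Vec using (Vec; []; _∷_; lookup; tabulate)
open import Data.Vec.Relation.Unary.Any as Anyᵥ using (here; there)
open import Data.Vec.Membership.Propositional using () renaming (_∈_ to _∈ᵥ_; _∉_ to _∉ᵥ_)
open import Data.Vec.Membership.Propositional.Properties using () renaming (∈-lookup to ∈ᵥ-lookup)
import Data.Vec.Properties as Vecₚ
open import Function using (_∘_; id; case_of_)
open import Function.Definitions using (Injective)
open import Relation.Binary.PropositionalEquality
open import Relation.Nullary using (¬_; Dec; yes; no; does; proof)
open import Relation.Nullary.Decidable using (dec-true; dec-false; ¬¬-excluded-middle)
open import Relation.Nullary.Reflects using (Reflects; invert)

does⇒ : ∀ {P : Set} (P? : Dec P) → does P? ≡ true → P
does⇒ P? h = invert (subst (Reflects _) h (proof P?))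

does⇏ : ∀ {P : Set} (P? : Dec P) → does P? ≡ false → ¬ P
does⇏ P? h = invert (subst (Reflects _) h (proof P?))

true≢false : true ≢ false
true≢false ()

∧-true⁻ : ∀ {b c} → b ∧ c ≡ true → b ≡ true × c ≡ true
∧-true⁻ {true} {true} _ = refl , refl

not-∨-false : ∀ a b c d → not (a ∨ b ∨ c ∨ d) ≡ true →
              a ≡ false × b ≡ false × c ≡ false × d ≡ false
not-∨-false false false false false _ = refl , refl , refl , refl

∧-not-not : ∀ a b c → (a ∧ not b) ∧ not c ≡ a ∧ not (c ∨ b)
∧-not-not false b     c     = refl
∧-not-not true  b     true  = Boolₚ.∧-zeroʳ _
∧-not-not true  true  false = refl
∧-not-not true  false false = refl

∧-∨-absorb : ∀ a b c → (a ∧ (b ∨ c)) ∧ b ≡ a ∧ b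
∧-∨-absorb false b     c     = refl
∧-∨-absorb true  true  c     = refl
∧-∨-absorb true  false false = refl
∧-∨-absorb true  false true  = refl

∧-∨-not : ∀ a b c → (b ≡ true → c ≡ false) → (a ∧ (b ∨ c)) ∧ not b ≡ a ∧ c
∧-∨-not a true  c c≡false rewrite c≡false refl = trans (Boolₚ.∧-zeroʳ _) (sym (Boolₚ.∧-zeroʳ a))
∧-∨-not a false c _ = Boolₚ.∧-identityʳ _

eqF⇒≡ : ∀ {n} {x y : Fin n} → eqF x y ≡ true → x ≡ y
eqF⇒≡ {x = x} {y} = does⇒ (x Fin.≟ y)

eqF-refl : ∀ {n} (x : Fin n) → eqF x x ≡ true
eqF-refl x = dec-true (x Fin.≟ x) refl

¬¬-decidable : ∀ {n} (P : Fin n → Set) → ¬ ¬ (∀ v → Dec (P v))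
¬¬-decidable {ℕ.zero}  P k = k (λ ())
¬¬-decidable {ℕ.suc n} P k = ¬¬-excluded-middle λ P₀? → ¬¬-decidable (P ∘ suc) λ P₊? →
  k λ { zero → P₀? ; (suc v) → P₊? v }

bit : Bool → ℕ
bit false = 0
bit true  = 1

bit-mono : ∀ {b c} → (b ≡ true → c ≡ true) → bit b ≤ bit c
bit-mono {false} _ = z≤n
bit-mono {true}  h rewrite h refl = ≤-refl

bit-split : ∀ b c → bit b ≡ bit (b ∧ c) + bit (b ∧ not c)
bit-split false c     = refl
bit-split true  false = refl
bit-split true  true  = refl

bit≤1 : ∀ b → bit b ≤ 1
bit≤1 false = z≤n
bit≤1 true  = ≤-refl

1≤bit⇒true : ∀ {b} → 1 ≤ bit b → b ≡ true
1≤bit⇒true {true} _ = refl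

+-≤-tight : ∀ {a b c d} → a ≤ c → b ≤ d → c + d ≤ a + b → c ≤ a × d ≤ b
+-≤-tight {a} {b} {c} {d} a≤c b≤d c+d≤a+b =
  +-cancelʳ-≤ d c a (≤-trans c+d≤a+b (+-monoʳ-≤ a b≤d)) ,
  +-cancelˡ-≤ c d b (≤-trans c+d≤a+b (+-monoˡ-≤ b a≤c))

-- Counting Boolean predicates on Fin n and on lists

module _ {n : ℕ} where

  _⊆_ : (Fin n → Bool) → (Fin n → Bool) → Set
  p ⊆ q = ∀ v → p v ≡ true → q v ≡ true

count : ∀ {n} → (Fin n → Bool) → ℕ
count {ℕ.zero} p = 0
count {ℕ.suc n} p = bit (p zero) + count (p ∘ suc)

count-cong : ∀ {n} {p q : Fin n → Bool} → (∀ v → p v ≡ q v) → count p ≡ count q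
count-cong {ℕ.zero}  _ = refl
count-cong {ℕ.suc n} h = cong₂ _+_ (cong bit (h zero)) (count-cong (h ∘ suc))

count-mono : ∀ {n} {p q : Fin n → Bool} → p ⊆ q → count p ≤ count q
count-mono {ℕ.zero}  _ = z≤n
count-mono {ℕ.suc n} h = +-mono-≤ (bit-mono (h zero)) (count-mono (h ∘ suc))

count-mono-< : ∀ {n} {p q : Fin n → Bool} → p ⊆ q →
               ∀ w → q w ≡ true → p w ≡ false → count p < count q
count-mono-< h zero    qw pw rewrite qw | pw = s≤s (count-mono (h ∘ suc))
count-mono-< h (suc w) qw pw = +-mono-≤-< (bit-mono (h zero)) (count-mono-< (h ∘ suc) w qw pw)

count-≤⇒⊇ : ∀ {n} {p q : Fin n → Bool} → p ⊆ q → count q ≤ count p → q ⊆ p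
count-≤⇒⊇ {p = p} p⊆q q≤p w qw with p w in pw
... | true  = refl
... | false = ⊥-elim (<⇒≱ (count-mono-< p⊆q w qw pw) q≤p)

count-split : ∀ {n} (p q : Fin n → Bool) →
              count p ≡ count (λ v → p v ∧ q v) + count (λ v → p v ∧ not (q v))
count-split {ℕ.zero}  p q = refl
count-split {ℕ.suc n} p q =
  trans (cong₂ _+_ (bit-split (p zero) (q zero)) (count-split (p ∘ suc) (q ∘ suc)))
        (interchange +-commutativeSemigroup (bit (p₀ ∧ q₀)) (bit (p₀ ∧ not q₀))
          (count (λ v → p (suc v) ∧ q (suc v))) (count (λ v → p (suc v) ∧ not (q (suc v)))))
  where
  p₀ q₀ : Bool
  p₀ = p zero
  q₀ = q zero

count-true : ∀ n → count {n} (λ _ → true) ≡ n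
count-true ℕ.zero    = refl
count-true (ℕ.suc n) = cong ℕ.suc (count-true n)

count-false : ∀ {n} {p : Fin n → Bool} → (∀ v → p v ≡ false) → count p ≡ 0
count-false {ℕ.zero}  h = refl
count-false {ℕ.suc n} h rewrite h zero = count-false (h ∘ suc)

count-at : ∀ {n} (p : Fin n → Bool) x → count (λ v → p v ∧ eqF v x) ≡ bit (p x)
count-at p zero =
  trans (cong₂ _+_ (cong bit (Boolₚ.∧-identityʳ (p zero)))
                   (count-false (λ v → Boolₚ.∧-zeroʳ (p (suc v)))))
        (+-identityʳ _)
count-at p (suc x) =
  trans (cong₂ _+_ (cong bit (Boolₚ.∧-zeroʳ (p zero))) refl) (count-at (p ∘ suc) x)

count-minus : ∀ {n} (p : Fin n → Bool) x → count p ≡ bit (p x) + count (λ v → p v ∧ not (eqF v x))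
count-minus p x = trans (count-split p (λ v → eqF v x)) (cong₂ _+_ (count-at p x) refl)

count-pair : ∀ {n} (p : Fin n → Bool) {x y} → x ≢ y →
             count (λ v → p v ∧ (eqF v x ∨ eqF v y)) ≡ bit (p x) + bit (p y)
count-pair p {x} {y} x≢y =
  trans (count-split _ (λ v → eqF v x))
        (cong₂ _+_ (trans (count-cong at-x) (count-at p x))
                   (trans (count-cong at-y) (count-at p y)))
  where
  at-x : ∀ v → (p v ∧ (eqF v x ∨ eqF v y)) ∧ eqF v x ≡ p v ∧ eqF v x
  at-x v = ∧-∨-absorb (p v) (eqF v x) (eqF v y)
  at-y : ∀ v → (p v ∧ (eqF v x ∨ eqF v y)) ∧ not (eqF v x) ≡ p v ∧ eqF v y
  at-y v = ∧-∨-not (p v) (eqF v x) (eqF v y)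
             (λ v≡x → dec-false (v Fin.≟ y) (x≢y ∘ trans (sym (eqF⇒≡ v≡x))))

countB-∷ : ∀ {A : Set} (p : A → Bool) x xs → countB p (x ∷ xs) ≡ bit (p x) + countB p xs
countB-∷ p x xs with p x
... | true  = refl
... | false = refl

countB-tabulate : ∀ {A : Set} {n} (p : A → Bool) (f : Fin n → A) →
                  countB p (List.tabulate f) ≡ count (p ∘ f)
countB-tabulate {n = ℕ.zero}  p f = refl
countB-tabulate {n = ℕ.suc n} p f =
  trans (countB-∷ p (f zero) _) (cong (bit (p (f zero)) +_) (countB-tabulate p (f ∘ suc)))

countB-allFin : ∀ {n} (p : Fin n → Bool) → countB p (allFin n) ≡ count p
countB-allFin p = countB-tabulate p id

countB-not : ∀ {A : Set} (p : A → Bool) xs → countB (not ∘ p) xs + countB p xs ≡ length xs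
countB-not p [] = refl
countB-not p (x ∷ xs) rewrite countB-∷ (not ∘ p) x xs | countB-∷ p x xs with p x
... | true  = trans (+-suc _ _) (cong ℕ.suc (countB-not p xs))
... | false = cong ℕ.suc (countB-not p xs)

∣∣≡count : ∀ {n} (S : Subset n) → ∣ S ∣ ≡ count (lookup S)
∣∣≡count []          = refl
∣∣≡count (true  ∷ S) = cong ℕ.suc (∣∣≡count S)
∣∣≡count (false ∷ S) = ∣∣≡count S

∣tabulate∣ : ∀ {n} (p : Fin n → Bool) → ∣ tabulate p ∣ ≡ count p
∣tabulate∣ p = trans (∣∣≡count (tabulate p)) (count-cong (Vecₚ.lookup∘tabulate p))

allB⁻ : ∀ {A : Set} {p : A → Bool} {xs x} → allB p xs ≡ true → x ∈ xs → p x ≡ true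
allB⁻ {p = p} {y ∷ _} h x∈xs with p y in py | x∈xs
... | true | here refl   = py
... | true | there x∈ys = allB⁻ h x∈ys

allB⁺ : ∀ {A : Set} {p : A → Bool} xs → (∀ x → x ∈ xs → p x ≡ true) → allB p xs ≡ true
allB⁺ [] h = refl
allB⁺ (y ∷ ys) h rewrite h y (here refl) = allB⁺ ys (λ x → h x ∘ there)

allB-false : ∀ {A : Set} {p : A → Bool} {xs x} → x ∈ xs → p x ≡ false → allB p xs ≡ false
allB-false {p = p} {xs} x∈xs px with allB p xs in all-p
... | false = refl
... | true  = ⊥-elim (true≢false (trans (sym (allB⁻ all-p x∈xs)) px))

maxList-upper : ∀ {xs x} → x ∈ xs → x ≤ maxList xs
maxList-upper {y ∷ ys} (here refl) = m≤m⊔n y (maxList ys)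
maxList-upper {y ∷ ys} (there x∈ys) = ≤-trans (maxList-upper x∈ys) (m≤n⊔m y (maxList ys))

maxList-attained : ∀ xs → maxList xs ≡ 0 ⊎ maxList xs ∈ xs
maxList-attained [] = inj₁ refl
maxList-attained (y ∷ ys) with ⊔-sel y (maxList ys) | maxList-attained ys
... | inj₁ max≡y | _          = inj₂ (subst (_∈ y ∷ ys) (sym max≡y) (here refl))
... | inj₂ max≡m | inj₁ m≡0   = inj₁ (trans max≡m m≡0)
... | inj₂ max≡m | inj₂ m∈ys  = inj₂ (subst (_∈ y ∷ ys) (sym max≡m) (there m∈ys))

[]∈sublists : ∀ {A : Set} (xs : List A) → [] ∈ sublists xs
[]∈sublists []       = here refl
[]∈sublists (x ∷ xs) = ∈-++⁺ʳ (map (x ∷_) (sublists xs)) ([]∈sublists xs)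

data SublistView {A : Set} (x : A) (xs : List A) : List A → Set where
  keep : ∀ {ys} → ys ∈ sublists xs → SublistView x xs (x ∷ ys)
  skip : ∀ {ys} → ys ∈ sublists xs → SublistView x xs ys

sublistView : ∀ {A : Set} {x : A} {xs ys} → ys ∈ sublists (x ∷ xs) → SublistView x xs ys
sublistView {x = x} {xs} ys∈ with ∈-++⁻ (map (x ∷_) (sublists xs)) ys∈
... | inj₂ ys∈xs = skip ys∈xs
... | inj₁ ys∈map with ∈-map⁻ (x ∷_) ys∈map
...   | _ , zs∈xs , refl = keep zs∈xs

sublists⇒⊆ : ∀ {A : Set} {xs ys : List A} {y} → ys ∈ sublists xs → y ∈ ys → y ∈ xs
sublists⇒⊆ {xs = []} (here refl) ()
sublists⇒⊆ {xs = x ∷ xs} ys∈ y∈ys with sublistView {x = x} {xs} ys∈ | y∈ys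
... | keep zs∈ | here refl = here refl
... | keep zs∈ | there y∈zs = there (sublists⇒⊆ zs∈ y∈zs)
... | skip zs∈ | y∈zs = there (sublists⇒⊆ zs∈ y∈zs)

countB-sublist : ∀ {A : Set} (p : A → Bool) {xs ys} → Unique xs → ys ∈ sublists xs →
                 (∀ {y} → y ∈ xs → p y ≡ true → y ∈ ys) → countB p xs ≡ countB p ys
countB-sublist p {[]} _ (here refl) _ = refl
countB-sublist p {x ∷ xs} (x∉xs ∷ unique) ys∈ complete with sublistView {x = x} {xs} ys∈
... | keep {zs} zs∈ =
  trans (countB-∷ p x xs)
        (trans (cong (bit (p x) +_) (countB-sublist p unique zs∈ complete′))
               (sym (countB-∷ p x zs)))
  where
  complete′ : ∀ {y} → y ∈ xs → p y ≡ true → y ∈ zs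
  complete′ y∈xs py with complete (there y∈xs) py
  ... | here refl  = ⊥-elim (Allₚ.All¬⇒¬Any x∉xs y∈xs)
  ... | there y∈zs = y∈zs
... | skip zs∈ with p x in px
...   | true  = ⊥-elim (Allₚ.All¬⇒¬Any x∉xs (sublists⇒⊆ zs∈ (complete (here refl) px)))
...   | false = countB-sublist p unique zs∈ (complete ∘ there)

-- Stable sets, α, core and corona

allSubsets-complete : ∀ {n} (S : Subset n) → S ∈ allSubsets n
allSubsets-complete []                = here refl
allSubsets-complete {ℕ.suc n} (true  ∷ S) = ∈-++⁺ˡ (∈-map⁺ (true ∷_) (allSubsets-complete S))
allSubsets-complete {ℕ.suc n} (false ∷ S) =
  ∈-++⁺ʳ (map (true ∷_) (allSubsets n)) (∈-map⁺ (false ∷_) (allSubsets-complete S))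

Stable : ∀ {n} → Adj n → (Fin n → Bool) → Set
Stable a p = ∀ u v → p u ≡ true → p v ≡ true → a u v ≡ true → ⊥

Maximum : ∀ {n} → Adj n → (Fin n → Bool) → Set
Maximum a p = Stable a p × count p ≡ α a

Stable-neighbour : ∀ {n} {a : Adj n} {p} → Stable a p → ∀ {s t} → a s t ≡ true →
                   p s ≡ true → p t ≡ false
Stable-neighbour {p = p} stable {s} {t} ast ps with p t in pt
... | true  = ⊥-elim (stable s t ps pt ast)
... | false = refl

module _ {n : ℕ} (a : Adj n) where

  isStable⇒Stable : ∀ S → isStable a S ≡ true → Stable a (lookup S)
  isStable⇒Stable S h u v Su Sv auv =
    true≢false (trans (sym (allB⁻ (allB⁻ h (∈-allFin u)) (∈-allFin v)))
                      (cong₂ (λ b c → not (b ∧ c)) Su (cong₂ _∧_ Sv auv)))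

  isStable-tabulate : ∀ {p} → Stable a p → isStable a (tabulate p) ≡ true
  isStable-tabulate {p} st = allB⁺ (allFin n) (λ u _ → allB⁺ (allFin n) (λ v _ → no-edge u v))
    where
    no-edge : ∀ u v → not (lookup (tabulate p) u ∧ lookup (tabulate p) v ∧ a u v) ≡ true
    no-edge u v rewrite Vecₚ.lookup∘tabulate p u | Vecₚ.lookup∘tabulate p v
      with p u in pu | p v in pv | a u v in auv
    ... | true  | true | true  = ⊥-elim (st u v pu pv auv)
    ... | true  | true | false = refl
    ... | true  | false | _    = refl
    ... | false | _    | _     = refl

  ∈stableSets : ∀ S → isStable a S ≡ true → S ∈ stableSets a
  ∈stableSets S = ∈-filter⁺ (λ S → isStable a S Bool.≟ true) (allSubsets-complete S)

  count≤α : ∀ {p} → Stable a p → count p ≤ α a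
  count≤α {p} st = subst (_≤ α a) (∣tabulate∣ p)
    (maxList-upper (∈-map⁺ ∣_∣ (∈stableSets (tabulate p) (isStable-tabulate st))))

  α-attained : 0 < α a → ∃ (Maximum a)
  α-attained 0<α with maxList-attained (map ∣_∣ (stableSets a))
  ... | inj₁ α≡0 = ⊥-elim (<-irrefl (sym α≡0) 0<α)
  ... | inj₂ α∈sizes with ∈-map⁻ ∣_∣ α∈sizes
  ...   | S , S∈ , α≡∣S∣ =
    lookup S ,
    isStable⇒Stable S (proj₂ (∈-filter⁻ (λ S → isStable a S Bool.≟ true) {xs = allSubsets n} S∈)) ,
    trans (sym (∣∣≡count S)) (sym α≡∣S∣)

  Maximum⇒∈Ω : ∀ {p} → Maximum a p → tabulate p ∈ Ω a
  Maximum⇒∈Ω {p} (st , size) =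
    ∈-filter⁺ (λ S → ∣ S ∣ ℕ.≟ α a) (∈stableSets (tabulate p) (isStable-tabulate st))
              (trans (∣tabulate∣ p) size)

  ∈Ω⇒Maximum : ∀ {S} → S ∈ Ω a → Maximum a (lookup S)
  ∈Ω⇒Maximum {S} S∈Ω with ∈-filter⁻ (λ S → ∣ S ∣ ℕ.≟ α a) {xs = stableSets a} S∈Ω
  ... | S∈ , size =
    isStable⇒Stable S (proj₂ (∈-filter⁻ (λ S → isStable a S Bool.≟ true) {xs = allSubsets n} S∈)) ,
    trans (sym (∣∣≡count S)) size

α-bounded : ∀ {n} (a : Adj n) {k} → (∀ {p} → Stable a p → count p ≤ k) → α a ≤ k
α-bounded a bound with α a in α≡
... | ℕ.zero  = z≤n
... | ℕ.suc _ with α-attained a (subst (0 <_) (sym α≡) (s≤s z≤n))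
...   | p , stable , size = subst (_≤ _) (trans size α≡) (bound stable)

inCore : ∀ {n} → Adj n → Fin n → Bool
inCore a v = allB (λ S → lookup S v) (Ω a)

outsideCorona : ∀ {n} → Adj n → Fin n → Bool
outsideCorona a v = allB (λ S → not (lookup S v)) (Ω a)

module _ {n : ℕ} (a : Adj n) where

  inCore-intro : ∀ {v} → (∀ {p} → Maximum a p → p v ≡ true) → inCore a v ≡ true
  inCore-intro h = allB⁺ (Ω a) (λ S S∈Ω → h (∈Ω⇒Maximum a S∈Ω))

  inCore-false : ∀ {p v} → Maximum a p → p v ≡ false → inCore a v ≡ false
  inCore-false {p} {v} max pv =
    allB-false (Maximum⇒∈Ω a max) (trans (Vecₚ.lookup∘tabulate p v) pv)

  outsideCorona-intro : ∀ {v} → (∀ {p} → Maximum a p → p v ≡ false) → outsideCorona a v ≡ true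
  outsideCorona-intro h = allB⁺ (Ω a) (λ S S∈Ω → cong not (h (∈Ω⇒Maximum a S∈Ω)))

  outsideCorona-false : ∀ {p v} → Maximum a p → p v ≡ true → outsideCorona a v ≡ false
  outsideCorona-false {p} {v} max pv =
    allB-false (Maximum⇒∈Ω a max) (cong not (trans (Vecₚ.lookup∘tabulate p v) pv))

  ξ≡count-inCore : ξ a ≡ count (inCore a)
  ξ≡count-inCore = countB-allFin (inCore a)

  σ≡count-outsideCorona : σ a ≡ count (outsideCorona a)
  σ≡count-outsideCorona = countB-allFin (outsideCorona a)

-- Matchings

Edge : ℕ → Set
Edge n = Fin n × Fin n

module _ {n : ℕ} (a : Adj n) where

  private
    ordered : Edge n → Bool
    ordered (x , y) = does (x Fin.<? y) ∧ a x y

    row : Fin n → List (Edge n)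
    row x = filter (λ e → ordered e Bool.≟ true) (map (x ,_) (allFin n))

  edges-sound : ∀ {e} → e ∈ edges a → proj₁ e Fin.< proj₂ e × a (proj₁ e) (proj₂ e) ≡ true
  edges-sound {e} e∈edges with Any.satisfied (∈-concatMap⁻ row {xs = allFin n} e∈edges)
  ... | x , e∈row with ∧-true⁻ (proj₂ (∈-filter⁻ (λ e → ordered e Bool.≟ true)
                                                   {xs = map (x ,_) (allFin n)} e∈row))
  ...   | x<y , axy = does⇒ (proj₁ e Fin.<? proj₂ e) x<y , axy

  edges-unique : Unique (edges a)
  edges-unique = Uniqueₚ.concat⁺ rows-unique rows-disjoint
    where
    fst∈row : ∀ {x e} → e ∈ row x → proj₁ e ≡ x
    fst∈row {x} e∈row with ∈-map⁻ (x ,_) (proj₁ (∈-filter⁻ (λ e → ordered e Bool.≟ true)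
                                                 {xs = map (x ,_) (allFin n)} e∈row))
    ... | _ , _ , refl = refl
    rows-unique : All Unique (map row (allFin n))
    rows-unique = Allₚ.map⁺ (All.universal (λ x → Uniqueₚ.filter⁺ _
                    (Uniqueₚ.map⁺ (cong proj₂) (Uniqueₚ.allFin⁺ n))) (allFin n))
    rows-disjoint : AllPairs Disjoint (map row (allFin n))
    rows-disjoint = AllPairsₚ.map⁺ (AllPairs.map
      (λ x≢y {_} (e∈x , e∈y) → x≢y (trans (sym (fst∈row e∈x)) (fst∈row e∈y))) (Uniqueₚ.allFin⁺ n))

μ-attained : ∀ {n} (a : Adj n) →
             ∃ λ M → M ∈ sublists (edges a) × isMatching M ≡ true × length M ≡ μ a
μ-attained a with maxList-attained
  (map length (filter (λ M → isMatching M Bool.≟ true) (sublists (edges a))))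
... | inj₁ μ≡0 = [] , []∈sublists (edges a) , refl , sym μ≡0
... | inj₂ μ∈sizes with ∈-map⁻ length μ∈sizes
...   | M , M∈ , μ≡∣M∣ with ∈-filter⁻ (λ M → isMatching M Bool.≟ true) M∈
...     | M∈sublists , matching = M , M∈sublists , matching , sym μ≡∣M∣

module _ {n : ℕ} where

  covered : List (Edge n) → Fin n → Bool
  covered M v = anyB (λ e → eqF v (proj₁ e) ∨ eqF v (proj₂ e)) M

  uncovered : List (Edge n) → ℕ
  uncovered M = count (not ∘ covered M)

  hits : (Fin n → Bool) → Edge n → ℕ
  hits p (x , y) = bit (p x) + bit (p y)

  hitSum : (Fin n → Bool) → List (Edge n) → ℕ
  hitSum p []      = 0
  hitSum p (e ∷ M) = hits p e + hitSum p M

  Meets : (Fin n → Bool) → Edge n → Set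
  Meets p (x , y) = p x ≡ true ⊎ p y ≡ true

  Loopless : List (Edge n) → Set
  Loopless = All (λ e → proj₁ e ≢ proj₂ e)

disjoint⇒uncovered : ∀ {n} (x y : Fin n) M → allB (disjointE (x , y)) M ≡ true →
                     covered M x ≡ false × covered M y ≡ false
disjoint⇒uncovered x y [] _ = refl , refl
disjoint⇒uncovered x y ((u , v) ∷ M) disjoint with ∧-true⁻ disjoint
... | xy#uv , disjoint′ with not-∨-false (eqF x u) (eqF x v) (eqF y u) (eqF y v) xy#uv
                           | disjoint⇒uncovered x y M disjoint′
...   | x≢u , x≢v , y≢u , y≢v | x∉M , y∉M =
  cong₂ _∨_ (cong₂ _∨_ x≢u x≢v) x∉M , cong₂ _∨_ (cong₂ _∨_ y≢u y≢v) y∉M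

count-by-matching : ∀ {n} (p : Fin n → Bool) M → isMatching M ≡ true → Loopless M →
                    count p ≡ count (λ v → p v ∧ not (covered M v)) + hitSum p M
count-by-matching p [] _ _ =
  trans (count-cong (λ v → sym (Boolₚ.∧-identityʳ (p v)))) (sym (+-identityʳ _))
count-by-matching p ((x , y) ∷ M) matching (x≢y ∷ loopless) with ∧-true⁻ matching
... | disjoint , matching′ with disjoint⇒uncovered x y M disjoint
...   | x∉M , y∉M = begin
  count p                                       ≡⟨ count-by-matching p M matching′ loopless ⟩
  count q + hitSum p M                          ≡⟨ cong (_+ hitSum p M) (count-split q on-xy) ⟩
  count (λ v → q v ∧ on-xy v) + count (λ v → q v ∧ not (on-xy v)) + hitSum p M
    ≡⟨ cong₂ (λ h r → h + r + hitSum p M) q-on-xy (count-cong (λ v → ∧-not-not (p v) _ _)) ⟩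
  h + r + hitSum p M                            ≡⟨ cong (_+ hitSum p M) (+-comm h r) ⟩
  r + h + hitSum p M                            ≡⟨ +-assoc r h (hitSum p M) ⟩
  r + (h + hitSum p M)                          ∎
  where
  open ≡-Reasoning
  q on-xy : Fin _ → Bool
  q v = p v ∧ not (covered M v)
  on-xy v = eqF v x ∨ eqF v y
  h r : ℕ
  h = hits p (x , y)
  r = count (λ v → p v ∧ not (covered ((x , y) ∷ M) v))
  q-on-xy : count (λ v → q v ∧ on-xy v) ≡ h
  q-on-xy = trans (count-pair q x≢y)
    (cong₂ _+_ (cong bit (trans (cong (λ c → p x ∧ not c) x∉M) (Boolₚ.∧-identityʳ (p x))))
               (cong bit (trans (cong (λ c → p y ∧ not c) y∉M) (Boolₚ.∧-identityʳ (p y)))))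

hitSum-true : ∀ {n} (M : List (Edge n)) → hitSum (λ _ → true) M ≡ 2 * length M
hitSum-true []      = refl
hitSum-true (e ∷ M) = trans (cong (2 +_) (hitSum-true M)) (sym (*-suc 2 (length M)))

hitSum≡countB : ∀ {n} {p : Fin n → Bool} (q : Edge n → Bool) {M} →
                All (λ e → hits p e ≡ bit (q e)) M → hitSum p M ≡ countB q M
hitSum≡countB q []                   = refl
hitSum≡countB q {e ∷ M} (eq ∷ eqs) =
  trans (cong₂ _+_ eq (hitSum≡countB q eqs)) (sym (countB-∷ q e M))

AllEdges : ∀ {n} → Adj n → List (Edge n) → Set
AllEdges b = All (λ e → b (proj₁ e) (proj₂ e) ≡ true)

hits≤1 : ∀ {n} {b : Adj n} {p} → Stable b p → ∀ {x y} → b x y ≡ true → hits p (x , y) ≤ 1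
hits≤1 {p = p} stable {x} {y} bxy with p x in px | p y in py
... | true  | true  = ⊥-elim (stable x y px py bxy)
... | true  | false = ≤-refl
... | false | true  = ≤-refl
... | false | false = z≤n

meets⇒1≤hits : ∀ {n} (p : Fin n → Bool) e → Meets p e → 1 ≤ hits p e
meets⇒1≤hits p (x , y) (inj₁ px) rewrite px = s≤s z≤n
meets⇒1≤hits p (x , y) (inj₂ py) rewrite py = m≤n+m 1 (bit (p x))

1≤hits⇒meets : ∀ {n} (p : Fin n → Bool) e → 1 ≤ hits p e → Meets p e
1≤hits⇒meets p (x , y) 1≤hits with p x | p y
... | true  | _    = inj₁ refl
... | false | true = inj₂ refl

hitSum≤length : ∀ {n} {b : Adj n} {p} → Stable b p → ∀ {M} → AllEdges b M → hitSum p M ≤ length M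
hitSum≤length stable []           = z≤n
hitSum≤length {p = p} stable (bxy ∷ M⊆b) =
  +-mono-≤ (hits≤1 {p = p} stable bxy) (hitSum≤length {p = p} stable M⊆b)

length≤hitSum⇒meets : ∀ {n} {b : Adj n} {p} → Stable b p → ∀ {M} → AllEdges b M →
                      length M ≤ hitSum p M → All (Meets p) M
length≤hitSum⇒meets stable [] _ = []
length≤hitSum⇒meets {p = p} stable {e ∷ M} (be ∷ M⊆b) length≤ with
  +-≤-tight (hits≤1 {p = p} stable be) (hitSum≤length {p = p} stable M⊆b) length≤
... | 1≤hits , length≤′ = 1≤hits⇒meets p e 1≤hits ∷ length≤hitSum⇒meets stable M⊆b length≤′

meets⇒length≤hitSum : ∀ {n} {p : Fin n → Bool} {M} → All (Meets p) M → length M ≤ hitSum p M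
meets⇒length≤hitSum []                      = z≤n
meets⇒length≤hitSum {p = p} {e ∷ _} (meets ∷ all-meet) =
  +-mono-≤ (meets⇒1≤hits p e meets) (meets⇒length≤hitSum all-meet)

length<hitSum : ∀ {n} {p : Fin n → Bool} {M} → All (Meets p) M →
                ∀ {x y} → (x , y) ∈ M → p x ≡ true → p y ≡ true → length M < hitSum p M
length<hitSum (_ ∷ all-meet) (here refl) px py rewrite px | py =
  s≤s (s≤s (meets⇒length≤hitSum all-meet))
length<hitSum {p = p} {e ∷ M} (meets ∷ all-meet) (there xy∈M) px py =
  subst (_≤ hits p e + hitSum p M) (+-suc 1 (length M))
        (+-mono-≤ (meets⇒1≤hits p e meets) (length<hitSum all-meet xy∈M px py))

module MatchingBound {n : ℕ} {M : List (Edge n)} (matching : isMatching M ≡ true)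
                     (loopless : Loopless M) where

  private
    decompose : ∀ (p : Fin n → Bool) → count p ≡ count (λ v → p v ∧ not (covered M v)) + hitSum p M
    decompose p = count-by-matching p M matching loopless

    outside⊆uncovered : ∀ (p : Fin n → Bool) → (λ v → p v ∧ not (covered M v)) ⊆ (not ∘ covered M)
    outside⊆uncovered p v h = proj₂ (∧-true⁻ h)

  stable≤uncovered+length : ∀ {b p} → AllEdges b M → Stable b p → count p ≤ uncovered M + length M
  stable≤uncovered+length {p = p} M⊆b stable = subst (_≤ uncovered M + length M) (sym (decompose p))
    (+-mono-≤ (count-mono (outside⊆uncovered p)) (hitSum≤length {p = p} stable M⊆b))

  tight-stable : ∀ {b p} → AllEdges b M → Stable b p → uncovered M + length M ≤ count p →
                 (not ∘ covered M) ⊆ p × All (Meets p) M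
  tight-stable {p = p} M⊆b stable tight
    with +-≤-tight (count-mono (outside⊆uncovered p)) (hitSum≤length {p = p} stable M⊆b)
                   (subst (uncovered M + length M ≤_) (decompose p) tight)
  ... | uncovered≤ , length≤ =
    (λ v h → proj₁ (∧-true⁻ (count-≤⇒⊇ (outside⊆uncovered p) uncovered≤ v h))) ,
    length≤hitSum⇒meets {p = p} stable M⊆b length≤

  uncovered+length<count : ∀ {p} → (not ∘ covered M) ⊆ p → All (Meets p) M →
                           ∀ {x y} → (x , y) ∈ M → p x ≡ true → p y ≡ true →
                           uncovered M + length M < count p
  uncovered+length<count {p} uncovered⊆p all-meet xy∈M px py =
    subst (uncovered M + length M <_) (sym (decompose p))
      (+-mono-≤-< (count-mono (λ v h → cong₂ _∧_ (uncovered⊆p v h) h))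
                  (length<hitSum all-meet xy∈M px py))

-- Deleting an edge; paths in a forest

SameEdge : ∀ {n} → Fin n → Fin n → Edge n → Set
SameEdge u v (x , y) = (u ≡ x × v ≡ y) ⊎ (u ≡ y × v ≡ x)

SameEdge-swap : ∀ {n} {u v : Fin n} {e} → SameEdge u v e → SameEdge v u e
SameEdge-swap (inj₁ (u≡x , v≡y)) = inj₂ (v≡y , u≡x)
SameEdge-swap (inj₂ (u≡y , v≡x)) = inj₁ (v≡x , u≡y)

SameEdge-distinct : ∀ {n} {x y z z′ : Fin n} → x ≢ y → SameEdge z z′ (x , y) → z ≢ z′
SameEdge-distinct x≢y (inj₁ (refl , refl)) = x≢y
SameEdge-distinct x≢y (inj₂ (refl , refl)) = x≢y ∘ sym

SameEdge-shared : ∀ {n} {u v z z′ : Fin n} {e} → SameEdge u v e → SameEdge z z′ e → z ≡ u ⊎ z ≡ v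
SameEdge-shared (inj₁ (refl , refl)) (inj₁ (refl , refl)) = inj₁ refl
SameEdge-shared (inj₁ (refl , refl)) (inj₂ (refl , refl)) = inj₂ refl
SameEdge-shared (inj₂ (refl , refl)) (inj₁ (refl , refl)) = inj₂ refl
SameEdge-shared (inj₂ (refl , refl)) (inj₂ (refl , refl)) = inj₁ refl

SameEdge-both : ∀ {n} (P : Fin n → Set) {x y s t} → SameEdge s t (x , y) → P s → P t → P x × P y
SameEdge-both P (inj₁ (refl , refl)) Ps Pt = Ps , Pt
SameEdge-both P (inj₂ (refl , refl)) Ps Pt = Pt , Ps

SameEdge-adjacent : ∀ {n} {a : Adj n} → (∀ u v → a u v ≡ a v u) →
                    ∀ {x y s t} → a x y ≡ true → SameEdge s t (x , y) → a s t ≡ true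
SameEdge-adjacent a-sym axy (inj₁ (refl , refl)) = axy
SameEdge-adjacent a-sym axy (inj₂ (refl , refl)) = trans (a-sym _ _) axy

hits-SameEdge : ∀ {n} (p : Fin n → Bool) {x y s t} → SameEdge s t (x , y) →
                hits p (x , y) ≡ bit (p s) + bit (p t)
hits-SameEdge p (inj₁ (refl , refl)) = refl
hits-SameEdge p {x} {y} (inj₂ (refl , refl)) = +-comm (bit (p x)) (bit (p y))

Meets-other : ∀ {n} {p : Fin n → Bool} {x y s t} → SameEdge s t (x , y) → Meets p (x , y) →
              p s ≡ false → p t ≡ true
Meets-other (inj₁ (refl , refl)) (inj₁ ps) ps≡false = ⊥-elim (true≢false (trans (sym ps) ps≡false))
Meets-other (inj₁ (refl , refl)) (inj₂ pt) _        = pt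
Meets-other (inj₂ (refl , refl)) (inj₁ pt) _        = pt
Meets-other (inj₂ (refl , refl)) (inj₂ ps) ps≡false = ⊥-elim (true≢false (trans (sym ps) ps≡false))

module _ {n : ℕ} (b : Adj n) where

  deleteEdge-⊆ : ∀ {e u v} → deleteEdge b e u v ≡ true → b u v ≡ true
  deleteEdge-⊆ = proj₁ ∘ ∧-true⁻

  deleteEdge-removes : ∀ {e u v} → SameEdge u v e → deleteEdge b e u v ≡ false
  deleteEdge-removes {u = u} {v} (inj₁ (refl , refl)) rewrite eqF-refl u | eqF-refl v =
    Boolₚ.∧-zeroʳ (b u v)
  deleteEdge-removes {u = u} {v} (inj₂ (refl , refl)) rewrite eqF-refl u | eqF-refl v =
    trans (cong (λ c → b u v ∧ not c) (Boolₚ.∨-zeroʳ _)) (Boolₚ.∧-zeroʳ (b u v))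

  deleteEdge-keeps : ∀ {x y u v} → b u v ≡ true →
                     deleteEdge b (x , y) u v ≡ true ⊎ SameEdge u v (x , y)
  deleteEdge-keeps {x} {y} {u} {v} buv rewrite buv
    with eqF u x in ux | eqF v y in vy | eqF u y in uy | eqF v x in vx
  ... | true  | true  | _     | _     = inj₂ (inj₁ (eqF⇒≡ ux , eqF⇒≡ vy))
  ... | _     | _     | true  | true  = inj₂ (inj₂ (eqF⇒≡ uy , eqF⇒≡ vx))
  ... | false | _     | false | _     = inj₁ refl
  ... | false | _     | true  | false = inj₁ refl
  ... | true  | false | false | _     = inj₁ refl
  ... | true  | false | true  | false = inj₁ refl

Reach-snoc : ∀ {n} {b : Adj n} {t u v} → Reach b t u → b u v ≡ true → Reach b t v
Reach-snoc here         buv = step buv here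
Reach-snoc (step btw r) buv = step btw (Reach-snoc r buv)

data SimplePath {n} (b : Adj n) : Fin n → Fin n → (k : ℕ) → Vec (Fin n) (ℕ.suc k) → Set where
  nil  : ∀ {v} → SimplePath b v v 0 (v ∷ [])
  cons : ∀ {u w v k} {vs : Vec (Fin n) k} → b u w ≡ true → u ∉ᵥ w ∷ vs →
         SimplePath b w v k (w ∷ vs) → SimplePath b u v (ℕ.suc k) (u ∷ w ∷ vs)

SomeSimplePath : ∀ {n} → Adj n → Fin n → Fin n → Set
SomeSimplePath {n} b u v = ∃ λ k → ∃ λ (vs : Vec (Fin n) (ℕ.suc k)) → SimplePath b u v k vs

module _ {n : ℕ} {b : Adj n} where

  private
    suffix : ∀ {u w v k vs} → SimplePath b w v k vs → u ∈ᵥ vs → SomeSimplePath b u v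
    suffix nil                (here refl)  = _ , _ , nil
    suffix path@(cons _ _ _)  (here refl)  = _ , _ , path
    suffix (cons _ _ path)    (there u∈vs) = suffix path u∈vs

    prepend : ∀ {u w v k vs} → b u w ≡ true → u ∉ᵥ vs → SimplePath b w v k vs → SomeSimplePath b u v
    prepend buw u∉ nil                 = _ , _ , cons buw u∉ nil
    prepend buw u∉ path@(cons _ _ _)   = _ , _ , cons buw u∉ path

  Reach⇒SimplePath : ∀ {u v} → Reach b u v → SomeSimplePath b u v
  Reach⇒SimplePath here = _ , _ , nil
  Reach⇒SimplePath (step {u} buw r) with Reach⇒SimplePath r
  ... | _ , vs , path with Anyᵥ.any? (u Fin.≟_) vs
  ...   | yes u∈vs = suffix path u∈vs
  ...   | no  u∉vs = prepend buw u∉vs path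

  SimplePath-adjacent : ∀ {u v k vs} → SimplePath b u v k vs →
                        ∀ i → b (lookup vs (inject₁ i)) (lookup vs (suc i)) ≡ true
  SimplePath-adjacent (cons buw _ _)    zero    = buw
  SimplePath-adjacent (cons _   _ path) (suc i) = SimplePath-adjacent path i

  SimplePath-last : ∀ {u v k vs} → SimplePath b u v k vs → lookup vs (fromℕ k) ≡ v
  SimplePath-last nil             = refl
  SimplePath-last (cons _ _ path) = SimplePath-last path

  SimplePath-injective : ∀ {u v k vs} → SimplePath b u v k vs → Injective _≡_ _≡_ (lookup vs)
  SimplePath-injective nil {zero} {zero} _ = refl
  SimplePath-injective (cons _ _ _) {zero} {zero} _ = refl
  SimplePath-injective (cons {vs = vs} _ u∉ _) {zero} {suc j} u≡ =
    ⊥-elim (u∉ (subst (_∈ᵥ _) (sym u≡) (∈ᵥ-lookup j _)))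
  SimplePath-injective (cons {vs = vs} _ u∉ _) {suc i} {zero} ≡u =
    ⊥-elim (u∉ (subst (_∈ᵥ _) ≡u (∈ᵥ-lookup i _)))
  SimplePath-injective (cons _ _ path) {suc i} {suc j} eq = cong suc (SimplePath-injective path eq)

forest-edge-is-bridge : ∀ {n} {b : Adj n} → IsForest b → ∀ {s t e} → b s t ≡ true → s ≢ t →
                        SameEdge s t e → ¬ Reach (deleteEdge b e) t s
forest-edge-is-bridge {b = b} forest {s} {t} {e} bst s≢t st≈e r with Reach⇒SimplePath r
... | _ , _ , nil = s≢t refl
... | _ , _ , cons b′ts _ nil =
  true≢false (trans (sym b′ts) (deleteEdge-removes b (SameEdge-swap st≈e)))
... | ℕ.suc (ℕ.suc m) , vs , path@(cons _ _ (cons _ _ _)) = forest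
  (m , lookup vs , SimplePath-injective path ,
   (λ i → deleteEdge-⊆ b (SimplePath-adjacent path i)) ,
   subst (λ z → b z t ≡ true) (sym (SimplePath-last path)) bst)

-- α-critical edges

module CriticalEdge {n} (a : Adj n) {x y : Fin n} (x≢y : x ≢ y)
                    (critical : α a < α (deleteEdge a (x , y))) where

  private
    a′ : Adj n
    a′ = deleteEdge a (x , y)

    maximum′ : ∃ (Maximum a′)
    maximum′ = α-attained a′ (≤-trans (s≤s z≤n) critical)

    W : Fin n → Bool
    W = proj₁ maximum′

    W-stable : Stable a′ W
    W-stable = proj₁ (proj₂ maximum′)

    W-large : ℕ.suc (α a) ≤ count W
    W-large = subst (ℕ.suc (α a) ≤_) (sym (proj₂ (proj₂ maximum′))) critical

    W∖_ : Fin n → Fin n → Bool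
    (W∖ z) v = W v ∧ not (eqF v z)

    W∖endpoint-stable : ∀ {z z′} → SameEdge z z′ (x , y) → Stable a (W∖ z)
    W∖endpoint-stable {z} z≈ u v Wu Wv auv with deleteEdge-keeps a auv
    ... | inj₁ a′uv = W-stable u v (proj₁ (∧-true⁻ Wu)) (proj₁ (∧-true⁻ Wv)) a′uv
    ... | inj₂ uv≈ with SameEdge-shared uv≈ z≈
    ...   | inj₁ refl = true≢false (trans (sym (proj₂ (∧-true⁻ Wu))) (cong not (eqF-refl z)))
    ...   | inj₂ refl = true≢false (trans (sym (proj₂ (∧-true⁻ Wv))) (cong not (eqF-refl z)))

    endpoint-split : ∀ {z z′} → SameEdge z z′ (x , y) → 1 ≤ bit (W z) × α a ≤ count (W∖ z)
    endpoint-split {z} z≈ = +-≤-tight (bit≤1 (W z)) (count≤α a (W∖endpoint-stable z≈))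
                                      (subst (ℕ.suc (α a) ≤_) (count-minus W z) W-large)

  separating-maximum : ∀ {z z′} → SameEdge z z′ (x , y) →
                       ∃ λ p → Maximum a p × p z ≡ false × p z′ ≡ true
  separating-maximum {z} {z′} z≈ =
    W∖ z ,
    (W∖endpoint-stable z≈ ,
     ≤-antisym (count≤α a (W∖endpoint-stable z≈)) (proj₂ (endpoint-split z≈))) ,
    trans (cong (λ c → W z ∧ not c) (eqF-refl z)) (Boolₚ.∧-zeroʳ (W z)) ,
    cong₂ (λ c d → c ∧ not d) (1≤bit⇒true (proj₁ (endpoint-split (SameEdge-swap z≈))))
                              (dec-false (z′ Fin.≟ z) (SameEdge-distinct x≢y (SameEdge-swap z≈)))

  endpoint-not-in-core : ∀ {z z′} → SameEdge z z′ (x , y) → inCore a z ≡ false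
  endpoint-not-in-core z≈ with separating-maximum z≈
  ... | p , p-max , pz , _ = inCore-false a p-max pz

  endpoint-in-corona : ∀ {z z′} → SameEdge z z′ (x , y) → outsideCorona a z′ ≡ false
  endpoint-in-corona z≈ with separating-maximum z≈
  ... | p , p-max , _ , pz′ = outsideCorona-false a p-max pz′

-- König–Egerváry graphs

module KönigEgerváry {n} (G : Graph n) (ke : IsKE G) {M : List (Edge n)}
                     (M∈sublists : M ∈ sublists (edges (adj G))) (matching : isMatching M ≡ true)
                     (M-maximum : length M ≡ μ (adj G)) where

  private
    a : Adj n
    a = adj G
    open import Data.List.Membership.DecPropositional (≡-dec (Fin._≟_ {n}) (Fin._≟_ {n}))
      using (_∈?_)

  M-sound : ∀ {e} → e ∈ M → proj₁ e Fin.< proj₂ e × a (proj₁ e) (proj₂ e) ≡ true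
  M-sound = edges-sound a ∘ sublists⇒⊆ M∈sublists

  loopless : Loopless M
  loopless = All.tabulate λ e∈M x≡y → <-irrefl (cong Fin.toℕ x≡y) (proj₁ (M-sound e∈M))

  M⊆a : AllEdges a M
  M⊆a = All.tabulate (proj₂ ∘ M-sound)

  open MatchingBound matching loopless

  n≡uncovered+2μ : n ≡ uncovered M + 2 * length M
  n≡uncovered+2μ = begin
    n                                   ≡⟨ count-true n ⟨
    count {n} (λ _ → true)              ≡⟨ count-by-matching (λ _ → true) M matching loopless ⟩
    uncovered M + hitSum (λ _ → true) M ≡⟨ cong (uncovered M +_) (hitSum-true M) ⟩
    uncovered M + 2 * length M          ∎
    where open ≡-Reasoning

  α≡uncovered+μ : α a ≡ uncovered M + length M
  α≡uncovered+μ = +-cancelʳ-≡ (length M) _ _ (begin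
    α a + length M                 ≡⟨ cong (α a +_) M-maximum ⟩
    α a + μ a                      ≡⟨ ke ⟩
    n                              ≡⟨ n≡uncovered+2μ ⟩
    uncovered M + 2 * length M     ≡⟨ solve 2 (λ c m → c :+ con 2 :* m := c :+ m :+ m) refl
                                              (uncovered M) (length M) ⟩
    uncovered M + length M + length M ∎)
    where open ≡-Reasoning

  maximum-structure : ∀ {p} → Maximum a p → (not ∘ covered M) ⊆ p × All (Meets p) M
  maximum-structure (stable , size) =
    tight-stable M⊆a stable (≤-reflexive (trans (sym α≡uncovered+μ) (sym size)))

  uncovered⇒inCore : ∀ {v} → covered M v ≡ false → inCore a v ≡ true
  uncovered⇒inCore v∉M = inCore-intro a (λ p-max → proj₁ (maximum-structure p-max) _ (cong not v∉M))

  critical⇒∈M : ∀ {e} → e ∈ edges a → isαCritical a e ≡ true → e ∈ M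
  critical⇒∈M {x , y} xy∈edges critical with (x , y) ∈? M
  ... | yes xy∈M = xy∈M
  ... | no  xy∉M = ⊥-elim (<⇒≱ (does⇒ (α a ℕ.<? α a′) critical) (α-bounded a′ λ stable →
                     ≤-trans (stable≤uncovered+length M⊆a′ stable)
                             (≤-reflexive (sym α≡uncovered+μ))))
    where
    a′ : Adj n
    a′ = deleteEdge a (x , y)
    M⊆a′ : AllEdges a′ M
    M⊆a′ = All.tabulate λ {(u , v)} uv∈M → case deleteEdge-keeps a (proj₂ (M-sound uv∈M)) of λ where
      (inj₁ a′uv) → a′uv
      (inj₂ (inj₁ (refl , refl))) → ⊥-elim (xy∉M uv∈M)
      (inj₂ (inj₂ (refl , refl))) →
        ⊥-elim (<-asym (proj₁ (M-sound uv∈M)) (proj₁ (edges-sound a xy∈edges)))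

  module ForestCut (S : Subset n) (S-max : Maximum a (lookup S))
                   (forest : IsForest (cutAdj a S)) where

    private
      inS : Fin n → Bool
      inS = lookup S

      S-stable : Stable a inS
      S-stable = proj₁ S-max

    edge-in-M : ∀ {x y s t} → (x , y) ∈ M → SameEdge s t (x , y) → a s t ≡ true
    edge-in-M xy∈M = SameEdge-adjacent (Graph.sym G) (proj₂ (M-sound xy∈M))

    uncovered-in-corona : ∀ {v} → covered M v ≡ false → outsideCorona a v ≡ false
    uncovered-in-corona v∉M =
      outsideCorona-false a S-max (proj₁ (maximum-structure S-max) _ (cong not v∉M))

    module Exchange {x y} (xy∈M : (x , y) ∈ M) {s t} (st≈xy : SameEdge s t (x , y))
                    (Ss : inS s ≡ true) {p} (p-max : Maximum a p) (ps : p s ≡ false)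
                    (reach? : ∀ v → Dec (Reach (deleteEdge (cutAdj a S) (x , y)) t v)) where

      private
        a′ : Adj n
        a′ = deleteEdge a (x , y)

        Reached : Fin n → Set
        Reached = Reach (deleteEdge (cutAdj a S) (x , y)) t

        ast : a s t ≡ true
        ast = edge-in-M xy∈M st≈xy

        St : inS t ≡ false
        St = Stable-neighbour S-stable ast Ss

        pt : p t ≡ true
        pt = Meets-other st≈xy (All.lookup (proj₂ (maximum-structure p-max)) xy∈M) ps

        s-unreached : ¬ Reached s
        s-unreached = forest-edge-is-bridge forest (cong₂ _∧_ ast (cong₂ _xor_ Ss St))
                        (λ s≡t → true≢false (trans (sym Ss) (trans (cong inS s≡t) St))) st≈xy

        W : Fin n → Bool
        W v = if does (reach? v) then p v else inS v

        W-both : ∀ {v} → p v ≡ true → inS v ≡ true → W v ≡ true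
        W-both {v} pv Sv with reach? v
        ... | yes _ = pv
        ... | no  _ = Sv

        not-deleted : ∀ {u v} → a′ u v ≡ true → ¬ SameEdge u v (x , y)
        not-deleted a′uv uv≈xy = true≢false (trans (sym a′uv) (deleteEdge-removes a uv≈xy))

        reach-absorbs-S : ∀ {u v} → Reached u → ¬ Reached v → inS v ≡ true → a u v ≡ true →
                          ¬ SameEdge u v (x , y) → ⊥
        reach-absorbs-S {u} {v} ru ¬rv Sv auv uv≉xy with inS u in Su
        ... | true  = S-stable u v Su Sv auv
        ... | false with deleteEdge-keeps (cutAdj a S) (cong₂ _∧_ auv (cong₂ _xor_ Su Sv))
        ...   | inj₁ F′uv  = ¬rv (Reach-snoc ru F′uv)
        ...   | inj₂ uv≈xy = uv≉xy uv≈xy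

        S-reach-closed : ∀ {u v} → Reached v → inS v ≡ true → a v u ≡ true → Reached u
        S-reach-closed rv Sv avu
          with deleteEdge-keeps (cutAdj a S)
                 (cong₂ _∧_ avu (cong₂ _xor_ Sv (Stable-neighbour S-stable avu Sv)))
        ... | inj₁ F′vu = Reach-snoc rv F′vu
        ... | inj₂ vu≈xy with SameEdge-shared st≈xy vu≈xy
        ...   | inj₁ refl = ⊥-elim (s-unreached rv)
        ...   | inj₂ refl = ⊥-elim (true≢false (trans (sym Sv) St))

        W-stable : Stable a′ W
        W-stable u v Wu Wv a′uv with reach? u | reach? v
        ... | yes _  | yes _  = proj₁ p-max u v Wu Wv (deleteEdge-⊆ a a′uv)
        ... | no  _  | no  _  = S-stable u v Wu Wv (deleteEdge-⊆ a a′uv)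
        ... | yes ru | no ¬rv = reach-absorbs-S ru ¬rv Wv (deleteEdge-⊆ a a′uv) (not-deleted a′uv)
        ... | no ¬ru | yes rv =
          reach-absorbs-S rv ¬ru Wu (trans (Graph.sym G v u) (deleteEdge-⊆ a a′uv))
                          (not-deleted a′uv ∘ SameEdge-swap)

        W-meets-edge : ∀ {u v} → a u v ≡ true → p u ≡ true → inS v ≡ true → Meets W (u , v)
        W-meets-edge {u} {v} auv pu Sv with reach? u | reach? v
        ... | yes _   | _      = inj₁ pu
        ... | no  _   | no  _  = inj₂ Sv
        ... | no  ¬ru | yes rv = ⊥-elim (¬ru (S-reach-closed rv Sv (trans (Graph.sym G v u) auv)))

        W-meets : All (Meets W) M
        W-meets = All.tabulate λ {(u , v)} uv∈M →
          meets (All.lookup (proj₂ (maximum-structure p-max)) uv∈M)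
                (All.lookup (proj₂ (maximum-structure S-max)) uv∈M) (proj₂ (M-sound uv∈M))
          where
          meets : ∀ {u v} → Meets p (u , v) → Meets inS (u , v) → a u v ≡ true → Meets W (u , v)
          meets (inj₁ pu) (inj₁ Su) _   = inj₁ (W-both pu Su)
          meets (inj₂ pv) (inj₂ Sv) _   = inj₂ (W-both pv Sv)
          meets (inj₁ pu) (inj₂ Sv) auv = W-meets-edge auv pu Sv
          meets (inj₂ pv) (inj₁ Su) auv = swap (W-meets-edge (trans (Graph.sym G _ _) auv) pv Su)

        Ws : W s ≡ true
        Ws with reach? s
        ... | yes rs = ⊥-elim (s-unreached rs)
        ... | no  _  = Ss

        Wt : W t ≡ true
        Wt with reach? t
        ... | yes _   = pt
        ... | no  ¬rt = ⊥-elim (¬rt here)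

        uncovered⊆W : (not ∘ covered M) ⊆ W
        uncovered⊆W v v∉M = W-both (proj₁ (maximum-structure p-max) v v∉M)
                                   (proj₁ (maximum-structure S-max) v v∉M)

        W-large : α a < count W
        W-large = subst (_< count W) (sym α≡uncovered+μ)
          (uncovered+length<count uncovered⊆W W-meets xy∈M (proj₁ W-xy) (proj₂ W-xy))
          where
          W-xy : W x ≡ true × W y ≡ true
          W-xy = SameEdge-both (λ z → W z ≡ true) st≈xy Ws Wt

      α<α′ : α a < α a′
      α<α′ = ≤-trans W-large (count≤α a′ W-stable)

    noncritical⇒S-end-in-every-maximum :
      ∀ {x y} → (x , y) ∈ M → isαCritical a (x , y) ≡ false →
      ∀ {s t} → SameEdge s t (x , y) → inS s ≡ true → ∀ {p} → Maximum a p → p s ≡ true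
    noncritical⇒S-end-in-every-maximum {x} {y} xy∈M noncritical {s} st≈xy Ss {p} p-max
      with p s in ps
    ... | true  = refl
    -- The goal is ⊥, so reachability in the forest minus xy may be assumed decidable.
    ... | false = ⊥-elim (¬¬-decidable _ λ reach? →
      does⇏ (α a ℕ.<? α (deleteEdge a (x , y))) noncritical
            (Exchange.α<α′ xy∈M st≈xy Ss p-max ps reach?))

    noncritical-endpoints :
      ∀ {x y} → (x , y) ∈ M → isαCritical a (x , y) ≡ false →
      ∀ {s t} → SameEdge s t (x , y) → inS s ≡ true →
      inCore a s ≡ true × inCore a t ≡ false × outsideCorona a s ≡ false × outsideCorona a t ≡ true
    noncritical-endpoints xy∈M noncritical {s} {t} st≈xy Ss =
      inCore-intro a s-in-every-maximum ,
      inCore-false a S-max (Stable-neighbour S-stable ast Ss) ,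
      outsideCorona-false a S-max Ss ,
      outsideCorona-intro a (λ p-max →
        Stable-neighbour (proj₁ p-max) ast (s-in-every-maximum p-max))
      where
      ast : a s t ≡ true
      ast = edge-in-M xy∈M st≈xy
      s-in-every-maximum : ∀ {p} → Maximum a p → p s ≡ true
      s-in-every-maximum = noncritical⇒S-end-in-every-maximum xy∈M noncritical st≈xy Ss

    critical-contribution : ∀ {x y} → (x , y) ∈ M → isαCritical a (x , y) ≡ true →
                            hits (inCore a) (x , y) ≡ 0 × hits (outsideCorona a) (x , y) ≡ 0
    critical-contribution {x} {y} xy∈M critical =
      cong₂ (λ b c → bit b + bit c) (C.endpoint-not-in-core xy≈xy) (C.endpoint-not-in-core yx≈xy) ,
      cong₂ (λ b c → bit b + bit c) (C.endpoint-in-corona yx≈xy) (C.endpoint-in-corona xy≈xy)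
      where
      module C = CriticalEdge a (All.lookup loopless xy∈M) (does⇒ (α a ℕ.<? _) critical)
      xy≈xy : SameEdge x y (x , y)
      xy≈xy = inj₁ (refl , refl)
      yx≈xy : SameEdge y x (x , y)
      yx≈xy = inj₂ (refl , refl)

    noncritical-contribution : ∀ {x y} → (x , y) ∈ M → isαCritical a (x , y) ≡ false →
                               hits (inCore a) (x , y) ≡ 1 × hits (outsideCorona a) (x , y) ≡ 1
    noncritical-contribution {x} {y} xy∈M noncritical =
      [ from-S-end (inj₁ (refl , refl)) , from-S-end (inj₂ (refl , refl)) ]′
        (All.lookup (proj₂ (maximum-structure S-max)) xy∈M)
      where
      from-S-end : ∀ {s t} → SameEdge s t (x , y) → inS s ≡ true →
                   hits (inCore a) (x , y) ≡ 1 × hits (outsideCorona a) (x , y) ≡ 1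
      from-S-end st≈xy Ss with noncritical-endpoints xy∈M noncritical st≈xy Ss
      ... | cs , ct , os , ot =
        trans (hits-SameEdge (inCore a) st≈xy) (cong₂ (λ b c → bit b + bit c) cs ct) ,
        trans (hits-SameEdge (outsideCorona a) st≈xy) (cong₂ (λ b c → bit b + bit c) os ot)

    edge-contribution : ∀ {e} → e ∈ M → hits (inCore a) e ≡ bit (not (isαCritical a e))
                                      × hits (outsideCorona a) e ≡ bit (not (isαCritical a e))
    edge-contribution {e} e∈M with isαCritical a e in critical
    ... | true  = critical-contribution e∈M critical
    ... | false = noncritical-contribution e∈M critical

    ξ≡uncovered+noncritical : ξ a ≡ uncovered M + countB (not ∘ isαCritical a) M
    ξ≡uncovered+noncritical = begin
      ξ a              ≡⟨ ξ≡count-inCore a ⟩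
      count (inCore a) ≡⟨ count-by-matching _ M matching loopless ⟩
      count (λ v → inCore a v ∧ not (covered M v)) + hitSum (inCore a) M
        ≡⟨ cong₂ _+_ (count-cong uncovered-part)
                     (hitSum≡countB _ (All.tabulate (proj₁ ∘ edge-contribution))) ⟩
      uncovered M + countB (not ∘ isαCritical a) M ∎
      where
      open ≡-Reasoning
      uncovered-part : ∀ v → inCore a v ∧ not (covered M v) ≡ not (covered M v)
      uncovered-part v with covered M v in cv
      ... | true  = Boolₚ.∧-zeroʳ _
      ... | false = trans (Boolₚ.∧-identityʳ _) (uncovered⇒inCore cv)

    σ≡noncritical : σ a ≡ countB (not ∘ isαCritical a) M
    σ≡noncritical = begin
      σ a                     ≡⟨ σ≡count-outsideCorona a ⟩
      count (outsideCorona a) ≡⟨ count-by-matching _ M matching loopless ⟩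
      count (λ v → outsideCorona a v ∧ not (covered M v)) + hitSum (outsideCorona a) M
        ≡⟨ cong₂ _+_ (count-false uncovered-part)
                     (hitSum≡countB _ (All.tabulate (proj₂ ∘ edge-contribution))) ⟩
      countB (not ∘ isαCritical a) M ∎
      where
      open ≡-Reasoning
      uncovered-part : ∀ v → outsideCorona a v ∧ not (covered M v) ≡ false
      uncovered-part v with covered M v in cv
      ... | true  = Boolₚ.∧-zeroʳ _
      ... | false = trans (Boolₚ.∧-identityʳ _) (uncovered-in-corona cv)

    η≡critical : η a ≡ countB (isαCritical a) M
    η≡critical = countB-sublist (isαCritical a) (edges-unique a) M∈sublists critical⇒∈M

    private
      N C : ℕ
      N = countB (not ∘ isαCritical a) M
      C = countB (isαCritical a) M

      N+C≡μ : N + C ≡ length M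
      N+C≡μ = countB-not (isαCritical a) M

    ξ+η≡α : ξ a + η a ≡ α a
    ξ+η≡α = begin
      ξ a + η a             ≡⟨ cong₂ _+_ ξ≡uncovered+noncritical η≡critical ⟩
      uncovered M + N + C   ≡⟨ +-assoc (uncovered M) N C ⟩
      uncovered M + (N + C) ≡⟨ cong (uncovered M +_) N+C≡μ ⟩
      uncovered M + length M ≡⟨ α≡uncovered+μ ⟨
      α a                   ∎
      where open ≡-Reasoning

    σ+η≡μ : σ a + η a ≡ μ a
    σ+η≡μ = begin
      σ a + η a ≡⟨ cong₂ _+_ σ≡noncritical η≡critical ⟩
      N + C     ≡⟨ N+C≡μ ⟩
      length M  ≡⟨ M-maximum ⟩
      μ a       ∎
      where open ≡-Reasoning

    ξ+2η+σ≡n : ξ a + 2 * η a + σ a ≡ n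
    ξ+2η+σ≡n = begin
      ξ a + 2 * η a + σ a
        ≡⟨ cong₂ _+_ (cong₂ _+_ ξ≡uncovered+noncritical (cong (2 *_) η≡critical)) σ≡noncritical ⟩
      uncovered M + N + 2 * C + N
        ≡⟨ solve 3 (λ c N C → c :+ N :+ con 2 :* C :+ N := c :+ con 2 :* (N :+ C)) refl
                 (uncovered M) N C ⟩
      uncovered M + 2 * (N + C) ≡⟨ cong (λ m → uncovered M + 2 * m) N+C≡μ ⟩
      uncovered M + 2 * length M ≡⟨ n≡uncovered+2μ ⟨
      n                          ∎
      where open ≡-Reasoning

proposition4p4 : ∀ (n : ℕ) (G : Graph n) → Connected G → HasEdge G → IsKE G
    → (∃ λ (S : Subset n) → IsMaxStable (adj G) S × IsForest (cutAdj (adj G) S))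
    → (ξ (adj G) + η (adj G) ≡ α (adj G))
      × (σ (adj G) + η (adj G) ≡ μ (adj G))
      × (ξ (adj G) + 2 * η (adj G) + σ (adj G) ≡ n)
proposition4p4 n G _ _ ke (S , (S-stable , S-size) , forest) with μ-attained (adj G)
... | M , M∈sublists , matching , M-maximum = ξ+η≡α , σ+η≡μ , ξ+2η+σ≡n
  where
  open KönigEgerváry G ke M∈sublists matching M-maximum
  open ForestCut S (isStable⇒Stable (adj G) S S-stable , trans (sym (∣∣≡count S)) S-size) forest
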